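{- In type $(B_n,n)$, let $O\subseteq Q$ be an order ideal and let $x<y$ be two distinct diagonal boxes of $O$. Let $S_1:(x,y)\to\{0,+,?\}$ be the filling that is $+$ at the box in the row of $y$ and the column of $x$, and $0$ at all other boxes of $(x,y)$. Then $(x,y,S_1)$ is a $\Gamma$-move.
   Context: $W$ is the Weyl group of type $B_n$ with simple reflections $s_1,\dots,s_n$ ($s_is_{i+1}$ of order 3 for $i\le n-2$, $s_{n-1}s_n$ of order 4, others commuting). $Q$: boxes $(r,c)$, $1\le r\le n$ (rows top to bottom), $1\le c\le n-r+1$, labeled $s_{(r,c)}=s_{r+c-1}$; diagonal boxes are those with $c=n-r+1$. Order: transitive closure of $(r,c)\lessdot(r,c+1)$ and $(r,c)\lessdot(r-1,c)$. For a convex subset $C\subseteq Q$ ($x,y\in C$, $x<z<y\Rightarrow z\in C$) and $D:C\to\{0,+\}$, with a linear extension $b_1,\dots,b_m$ of $C$, set $v(D)=t_m\cdots t_1$ where $t_k=s_{b_k}$ if $D(b_k)=0$ and $t_k=1$ if $D(b_k)=+$ (independent of the linear extension). $(x,y)=\{z:x<z<y\}$, $[x,y)$, $(x,y]$ similarly. $D$ of shape $(x,y)$ is compatible with $S:(x,y)\to\{0,+,?\}$ if $D(z)=S(z)$ whenever $S(z)\neq ?$. A $\Gamma$-move is a triple $(x,y,S)$ with $x<y$ distinct such that $v(D\cup x)=v(D\cup y)$ for every $D$ of shape $(x,y)$ compatible with $S$, where $D\cup x$ ($D\cup y$) is the diagram of shape $[x,y)$ ($(x,y]$) extending $D$ by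 $0$ at $x$ ($y$). -}

module Defs where

open import Data.Nat using (ℕ; zero; suc; _+_; _∸_; _≤_; _≡ᵇ_; _<ᵇ_)
open import Data.Bool using (Bool; true; false; if_then_else_; _∧_)
open import Data.Integer using (ℤ; +_; -[1+_]; -_)
open import Data.Fin using (Fin; toℕ) renaming (_<_ to _<F_)
open import Data.Vec using (Vec; tabulate)
open import Data.List using (List; []; _∷_; length; lookup)
open import Data.List.Relation.Unary.All using (All)
open import Data.List.Relation.Unary.Unique.Propositional using (Unique)
open import Data.List.Membership.Propositional using (_∈_)
open import Data.Product using (_×_)
open import Data.Sum using (_⊎_)
open import Relation.Binary.PropositionalEquality using (_≡_; _≢_)
open import Relation.Binary.Construct.Closure.Transitive using (TransClosure)

-- The Weyl group W(B_n), realised (faithfully) as the group of signed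
-- permutations of {±1,…,±n}.  An element w is stored as the vector
-- (w(1),…,w(n)) of integers in {±1,…,±n}; w(-i) = -w(i).

SP : ℕ → Set
SP n = Vec ℤ n

-- value of w at the (0-based) position j, i.e. w(j+1); 0 if out of range
at : ∀ {n} → Vec ℤ n → ℕ → ℤ
at Vec.[] _ = + 0
at (a Vec.∷ _) zero = a
at (_ Vec.∷ w) (suc j) = at w j

act : ∀ {n} → SP n → ℤ → ℤ
act w (+ zero) = + 0
act w (+ (suc j)) = at w j
act w (-[1+ j ]) = - at w j

_·_ : ∀ {n} → SP n → SP n → SP n
_·_ {n} u w = tabulate (λ i → act u (at w (toℕ i)))

idSP : ∀ n → SP n
idSP n = tabulate (λ i → + suc (toℕ i))

-- simple reflection s_k (1 ≤ k ≤ n):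
--   k < n : transposition of k and k+1 (and of -k and -(k+1));
--   k = n : sign change n ↦ -n.
gen : ∀ n → ℕ → SP n
gen n k = tabulate λ i → s (suc (toℕ i))
  where
  s : ℕ → ℤ
  s m = if k <ᵇ n
          then (if m ≡ᵇ k then + suc k else if m ≡ᵇ suc k then + k else + m)
          else (if (k ≡ᵇ n) ∧ (m ≡ᵇ n) then - (+ m) else + m)

record Box (n : ℕ) : Set where
  constructor box
  field
    r : ℕ
    c : ℕ
    .r≥1 : 1 ≤ r
    .r≤n : r ≤ n
    .c≥1 : 1 ≤ c
    .c≤  : c ≤ n ∸ r + 1
open Box public

label : ∀ {n} → Box n → ℕ
label b = r b + c b ∸ 1

Diagonal : ∀ {n} → Box n → Set
Diagonal {n} b = c b ≡ n ∸ r b + 1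

_⋖_ : ∀ {n} → Box n → Box n → Set
a ⋖ b = (r b ≡ r a × c b ≡ suc (c a)) ⊎ (suc (r b) ≡ r a × c b ≡ c a)

_<Q_ : ∀ {n} → Box n → Box n → Set
_<Q_ = TransClosure _⋖_

_≤Q_ : ∀ {n} → Box n → Box n → Set
a ≤Q b = a ≡ b ⊎ a <Q b

IsOrderIdeal : ∀ {n} → (Box n → Set) → Set
IsOrderIdeal {n} O = ∀ (a b : Box n) → a ≤Q b → O b → O a

data Fill : Set where
  f0 f+ : Fill

data Fill? : Set where
  s0 s+ s? : Fill?

_=ᵇ_ : ∀ {n} → Box n → Box n → Bool
a =ᵇ b = (r a ≡ᵇ r b) ∧ (c a ≡ᵇ c b)

letter : ∀ {n} → (Box n → Fill) → Box n → SP n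
letter {n} D b with D b
... | f0 = gen n (label b)
... | f+ = idSP n

-- v(D) = t_m ⋯ t_1 for the list b_1,…,b_m
vList : ∀ {n} → (Box n → Fill) → List (Box n) → SP n
vList {n} D [] = idSP n
vList D (b ∷ L) = vList D L · letter D b

IsLinExt : ∀ {n} → (Box n → Set) → List (Box n) → Set
IsLinExt {n} C L =
  All C L × Unique L × (∀ b → C b → b ∈ L) ×
  (∀ (i j : Fin (length L)) → lookup L i <Q lookup L j → i <F j)

Open : ∀ {n} → Box n → Box n → Box n → Set
Open x y z = x <Q z × z <Q y

HalfL : ∀ {n} → Box n → Box n → Box n → Set
HalfL x y z = x ≤Q z × z <Q y

HalfR : ∀ {n} → Box n → Box n → Box n → Set
HalfR x y z = x <Q z × z ≤Q y

_∪at_ : ∀ {n} → (Box n → Fill) → Box n → (Box n → Fill)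
(D ∪at x) z = if z =ᵇ x then f0 else D z

Compatible : ∀ {n} → Box n → Box n → (Box n → Fill?) → (Box n → Fill) → Set
Compatible x y S D = ∀ z → Open x y z →
  (S z ≡ s0 → D z ≡ f0) × (S z ≡ s+ → D z ≡ f+)

-- A diagram of shape (x,y) is modelled by a total
-- function Box n → Fill of which only the values on (x,y) matter; v is
-- computed along an arbitrary linear extension (it is independent of it).
IsΓMove : ∀ {n} → Box n → Box n → (Box n → Fill?) → Set
IsΓMove {n} x y S = x <Q y ×
  (∀ (D : Box n → Fill) → Compatible x y S D →
   ∀ (L₁ L₂ : List (Box n)) → IsLinExt (HalfL x y) L₁ → IsLinExt (HalfR x y) L₂ →
   vList (D ∪at x) L₁ ≡ vList (D ∪at y) L₂)

S₁ : ∀ {n} → Box n → Box n → Box n → Fill?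
S₁ x y z = if (r z ≡ᵇ r y) ∧ (c z ≡ᵇ c x) then s+ else s0

-- The value of a diagram does not depend on the linear extension, since two of them
-- differ by swaps of incomparable boxes, whose labels differ by at least 2. Reading
-- [x, y) as x followed by (x, y), and (x, y] as (x, y) followed by y, and noting that
-- the diagonal boxes x and y both carry s_n, gives v(D ∪ x) = w s_n and
-- v(D ∪ y) = s_n w for the product w over (x, y). As a signed permutation, w commutes
-- with s_n as soon as it fixes n. Following n through the letters of w: it goes down
-- by one at each box of the column of x, is left alone by the + at the corner (row of
-- y, column of x), and goes up by one at each box of the row of y, ending at
-- r y + c y - 1 = n; every other box has a label above the current value.

module Submission where

open import Defs
open import Data.Bool using (true; false; if_then_else_; _∧_; T)
open import Data.Bool.Properties using (∧-zeroʳ)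
open import Data.Empty using (⊥-elim)
open import Data.Fin using (Fin; toℕ) renaming (zero to fzero; suc to fsuc)
open import Data.Integer using (ℤ; +_; -[1+_]; -_)
import Data.Integer.Properties as ℤ
open import Data.List using (List; []; _∷_; _∷ʳ_; foldl; length; lookup)
open import Data.List.Properties using (foldl-∷ʳ)
open import Data.List.Membership.Propositional using (_∈_)
open import Data.List.Membership.Propositional.Properties using (∈-++⁺ˡ; ∈-++⁺ʳ; ∈-++⁻)
open import Data.List.Relation.Unary.All as All using (All; []; _∷_)
open import Data.List.Relation.Unary.AllPairs as AllPairs using (AllPairs; []; _∷_)
import Data.List.Relation.Unary.AllPairs.Properties as AllPairs
open import Data.List.Relation.Unary.Any as Any using (Any; here; there)
open import Data.List.Relation.Unary.Any.Properties using (lookup-index)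
open import Data.List.Relation.Unary.Unique.Propositional using (Unique)
import Data.List.Relation.Unary.Unique.Propositional.Properties as Unique
open import Data.Nat using (ℕ; zero; suc; pred; >-nonZero; _+_; _∸_; _≤_; _<_; _≡ᵇ_; _<ᵇ_; z≤n; s≤s)
open import Data.Nat.Properties
open import Data.Product using (Σ; _×_; _,_; proj₁; proj₂; map₁)
open import Data.Sum using (_⊎_; inj₁; inj₂; map₂; fromInj₁; fromInj₂)
open import Data.Unit using (tt)
open import Data.Vec using ([]; _∷_; tabulate)
open import Relation.Binary.Construct.Closure.Transitive using ([_]; _∷_)
open import Relation.Binary.PropositionalEquality hiding ([_])
open import Relation.Nullary using (¬_; yes; no)
open import Relation.Nullary.Decidable using (recompute)

if-true : ∀ {A : Set} {b} {u v : A} → b ≡ true → (if b then u else v) ≡ u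
if-true refl = refl

if-false : ∀ {A : Set} {b} {u v : A} → b ≡ false → (if b then u else v) ≡ v
if-false refl = refl

T⇒≡true : ∀ {b} → T b → b ≡ true
T⇒≡true {true} _ = refl

¬T⇒≡false : ∀ {b} → ¬ T b → b ≡ false
¬T⇒≡false {false} _ = refl
¬T⇒≡false {true} ¬t = ⊥-elim (¬t tt)

≡ᵇ-true : ∀ {m k} → m ≡ k → (m ≡ᵇ k) ≡ true
≡ᵇ-true {m} {k} m≡k = T⇒≡true (≡⇒≡ᵇ m k m≡k)

≡ᵇ-false : ∀ {m k} → m ≢ k → (m ≡ᵇ k) ≡ false
≡ᵇ-false {m} {k} m≢k = ¬T⇒≡false (λ t → m≢k (≡ᵇ⇒≡ m k t))

<ᵇ-true : ∀ {m k} → m < k → (m <ᵇ k) ≡ true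
<ᵇ-true m<k = T⇒≡true (<⇒<ᵇ m<k)

<ᵇ-false : ∀ {m k} → ¬ m < k → (m <ᵇ k) ≡ false
<ᵇ-false {m} {k} m≮k = ¬T⇒≡false (λ t → m≮k (<ᵇ⇒< m k t))

-- Composing commuting maps along differently ordered lists

-- applyAll f [b₁, …, bₘ] = f bₘ ∘ ⋯ ∘ f b₁, in the order of v(D) = t_m ⋯ t_1.
applyAll : ∀ {A B : Set} → (B → A → A) → List B → A → A
applyAll f L z = foldl (λ acc b → f b acc) z L

Ordered : ∀ {B : Set} → (B → B → Set) → List B → Set
Ordered _≺_ = AllPairs (λ a b → ¬ b ≺ a)

module Reorder {A B : Set} (_≺_ : B → B → Set) (f : B → A → A)
  (commute : ∀ a b → a ≢ b → ¬ a ≺ b → ¬ b ≺ a → ∀ z → f a (f b z) ≡ f b (f a z)) where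

  record MovedToFront (a : B) (L : List B) : Set where
    field
      rest : List B
      applyAll-rest : ∀ z → applyAll f L z ≡ applyAll f rest (f a z)
      rest⊆ : ∀ {b} → b ∈ rest → b ∈ L × b ≢ a
      ⊆rest : ∀ {b} → b ∈ L → b ≢ a → b ∈ rest
      unique : Unique rest
      ordered : Ordered _≺_ rest

  moveToFront : ∀ a L → a ∈ L → Unique L → Ordered _≺_ L →
    (∀ {p} → p ∈ L → p ≢ a → ¬ p ≺ a) → MovedToFront a L
  moveToFront a (a ∷ T) (here refl) (a∉T ∷ uT) (_ ∷ oT) _ = record
    { rest = T ; applyAll-rest = λ _ → refl
    ; rest⊆ = λ b∈T → there b∈T , λ { refl → All.lookup a∉T b∈T refl }
    ; ⊆rest = λ { (here refl) b≢a → ⊥-elim (b≢a refl) ; (there b∈T) _ → b∈T }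
    ; unique = uT ; ordered = oT }
  moveToFront a (h ∷ T) (there a∈T) (h∉T ∷ uT) (h≼T ∷ oT) a-first = record
    { rest = h ∷ rest
    ; applyAll-rest = λ z → trans (applyAll-rest (f h z)) (cong (applyAll f rest) (commute a h
        (≢-sym h≢a) (All.lookup h≼T a∈T) (a-first (here refl) h≢a) z))
    ; rest⊆ = λ { (here refl) → here refl , h≢a ; (there b∈) → map₁ there (rest⊆ b∈) }
    ; ⊆rest = λ { (here refl) _ → here refl ; (there b∈T) b≢a → there (⊆rest b∈T b≢a) }
    ; unique = All.tabulate (λ b∈ → All.lookup h∉T (proj₁ (rest⊆ b∈))) ∷ unique
    ; ordered = All.tabulate (λ b∈ → All.lookup h≼T (proj₁ (rest⊆ b∈))) ∷ ordered }
    where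
    h≢a : h ≢ a
    h≢a = All.lookup h∉T a∈T
    open MovedToFront (moveToFront a T a∈T uT oT (λ p∈T → a-first (there p∈T)))

  -- The head of L₁ is moved to the front of L₂ past elements incomparable with it.
  applyAll-reorder : ∀ L₁ L₂ → Unique L₁ → Unique L₂ → Ordered _≺_ L₁ → Ordered _≺_ L₂ →
    (∀ {b} → b ∈ L₁ → b ∈ L₂) → (∀ {b} → b ∈ L₂ → b ∈ L₁) →
    ∀ z → applyAll f L₁ z ≡ applyAll f L₂ z
  applyAll-reorder [] [] _ _ _ _ _ _ z = refl
  applyAll-reorder [] (h ∷ L₂) _ _ _ _ _ L₂⊆ z with L₂⊆ (here refl)
  ... | ()
  applyAll-reorder (a ∷ L₁) L₂ (a∉L₁ ∷ u₁) u₂ (a≼L₁ ∷ o₁) o₂ L₁⊆ L₂⊆ z =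
    trans (applyAll-reorder L₁ rest u₁ unique o₁ ordered L₁⊆rest rest⊆L₁ (f a z)) (sym (applyAll-rest z))
    where
    a-first : ∀ {p} → p ∈ L₂ → p ≢ a → ¬ p ≺ a
    a-first p∈ p≢a with L₂⊆ p∈
    ... | here p≡a = ⊥-elim (p≢a p≡a)
    ... | there p∈L₁ = All.lookup a≼L₁ p∈L₁
    open MovedToFront (moveToFront a L₂ (L₁⊆ (here refl)) u₂ o₂ a-first)
    L₁⊆rest : ∀ {b} → b ∈ L₁ → b ∈ rest
    L₁⊆rest b∈ = ⊆rest (L₁⊆ (there b∈)) (λ { refl → All.lookup a∉L₁ b∈ refl })
    rest⊆L₁ : ∀ {b} → b ∈ rest → b ∈ L₁
    rest⊆L₁ b∈ with rest⊆ b∈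
    ... | b∈L₂ , b≢a with L₂⊆ b∈L₂
    ...   | here b≡a = ⊥-elim (b≢a b≡a)
    ...   | there b∈L₁ = b∈L₁

linExt-ordered : ∀ {B : Set} {_≺_ : B → B → Set} L →
  (∀ (i j : Fin (length L)) → lookup L i ≺ lookup L j → toℕ i < toℕ j) → Ordered _≺_ L
linExt-ordered [] _ = []
linExt-ordered {_≺_ = _≺_} (a ∷ L) index< =
  All.tabulate (λ b∈L b≺a →
    n≮0 (index< (fsuc (Any.index b∈L)) fzero (subst (λ l → l ≺ a) (lookup-index b∈L) b≺a)))
  ∷ linExt-ordered L (λ i j i≺j → ≤-pred (index< (fsuc i) (fsuc j) i≺j))

-- Signed permutations as functions on ℤ

at-tabulate : ∀ n (g : ℕ → ℤ) j →
  at (tabulate {n = n} (λ i → g (toℕ i))) j ≡ (if j <ᵇ n then g j else + 0)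
at-tabulate zero g j = refl
at-tabulate (suc n) g zero = refl
at-tabulate (suc n) g (suc j) = at-tabulate n (λ m → g (suc m)) j

at-outside : ∀ {n} (w : SP n) j → (j <ᵇ n) ≡ false → at w j ≡ + 0
at-outside (a ∷ w) (suc j) j≮n = at-outside w j j≮n
at-outside [] j _ = refl

act-neg : ∀ {n} (u : SP n) z → act u (- z) ≡ - act u z
act-neg u (+ zero) = refl
act-neg u (+ suc j) = refl
act-neg u -[1+ j ] = sym (ℤ.neg-involutive _)

act-·-pos : ∀ {n} (u w : SP n) j → at (u · w) j ≡ act u (at w j)
act-·-pos {n} u w j with j <ᵇ n in j<n
... | true = trans (at-tabulate n (λ m → act u (at w m)) j) (if-true j<n)
... | false = trans (at-tabulate n (λ m → act u (at w m)) j)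
                (trans (if-false j<n) (cong (act u) (sym (at-outside w j j<n))))

act-· : ∀ {n} (u w : SP n) z → act (u · w) z ≡ act u (act w z)
act-· u w (+ zero) = refl
act-· u w (+ suc j) = act-·-pos u w j
act-· u w -[1+ j ] = trans (cong -_ (act-·-pos u w j)) (sym (act-neg u (at w j)))

act-injective : ∀ {n} (u w : SP n) → (∀ z → act u z ≡ act w z) → u ≡ w
act-injective [] [] _ = refl
act-injective (a ∷ u) (b ∷ w) same = cong₂ _∷_ (same (+ 1)) (act-injective u w same-tail)
  where
  same-tail : ∀ z → act u z ≡ act w z
  same-tail (+ zero) = refl
  same-tail (+ suc j) = same (+ suc (suc j))
  same-tail -[1+ j ] = same -[1+ suc j ]

-- act w sends every integer outside {±1,…,±n} to 0.
clip : ℕ → ℤ → ℤ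
clip n (+ zero) = + 0
clip n (+ suc j) = if j <ᵇ n then + suc j else + 0
clip n -[1+ j ] = if j <ᵇ n then -[1+ j ] else + 0

act-id : ∀ n z → act (idSP n) z ≡ clip n z
act-id n (+ zero) = refl
act-id n (+ suc j) = at-tabulate n (λ m → + suc m) j
act-id n -[1+ j ] with j <ᵇ n in j<n
... | true = cong -_ (trans (at-tabulate n (λ m → + suc m) j) (if-true j<n))
... | false = cong -_ (trans (at-tabulate n (λ m → + suc m) j) (if-false j<n))

clip-neg : ∀ n z → clip n (- z) ≡ - clip n z
clip-neg n (+ zero) = refl
clip-neg n (+ suc j) with j <ᵇ n
... | true = refl
... | false = refl
clip-neg n -[1+ j ] with j <ᵇ n
... | true = refl
... | false = refl

clip-idem : ∀ n z → clip n (clip n z) ≡ clip n z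
clip-idem n (+ zero) = refl
clip-idem n (+ suc j) with j <ᵇ n in j<n
... | true rewrite j<n = refl
... | false = refl
clip-idem n -[1+ j ] with j <ᵇ n in j<n
... | true rewrite j<n = refl
... | false = refl

clip-inside : ∀ n m → 1 ≤ m → m ≤ n → clip n (+ m) ≡ + m
clip-inside n (suc j) _ m≤n = if-true (<ᵇ-true m≤n)

clip-outside : ∀ n m → n < m → clip n (+ m) ≡ + 0
clip-outside n (suc j) (s≤s n≤j) = if-false (<ᵇ-false (λ j<n → <-irrefl refl (<-≤-trans j<n n≤j)))

clip-inside-neg : ∀ n j → j < n → clip n -[1+ j ] ≡ -[1+ j ]
clip-inside-neg n j j<n = if-true (<ᵇ-true j<n)

-- s_k as a map on all of ℤ; gen n k is σ n k followed by clip n.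

σ⁺ : ℕ → ℕ → ℕ → ℤ
σ⁺ n k m = if k <ᵇ n
           then (if m ≡ᵇ k then + suc k else if m ≡ᵇ suc k then + k else + m)
           else (if (k ≡ᵇ n) ∧ (m ≡ᵇ n) then - (+ m) else + m)

σ : ℕ → ℕ → ℤ → ℤ
σ n k (+ m) = σ⁺ n k m
σ n k -[1+ m ] = - σ⁺ n k (suc m)

module _ {n k : ℕ} where

  σ-up : k < n → σ n k (+ k) ≡ + suc k
  σ-up k<n = trans (if-true (<ᵇ-true k<n)) (if-true (≡ᵇ-true {k} refl))

  σ-down : k < n → σ n k (+ suc k) ≡ + k
  σ-down k<n = trans (if-true (<ᵇ-true k<n))
    (trans (if-false (≡ᵇ-false {suc k} (λ e → <-irrefl (sym e) ≤-refl))) (if-true (≡ᵇ-true {suc k} refl)))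

  σ-fix : ∀ {m} → k < n → m ≢ k → m ≢ suc k → σ n k (+ m) ≡ + m
  σ-fix {m} k<n m≢k m≢1+k =
    trans (if-true (<ᵇ-true k<n)) (trans (if-false (≡ᵇ-false m≢k)) (if-false (≡ᵇ-false m≢1+k)))

module _ {n : ℕ} where

  σₙ-flip : σ n n (+ n) ≡ - (+ n)
  σₙ-flip = trans (if-false (<ᵇ-false {n} (<-irrefl refl)))
                  (if-true (cong₂ _∧_ (≡ᵇ-true {n} refl) (≡ᵇ-true {n} refl)))

  σₙ-fix : ∀ {m} → m ≢ n → σ n n (+ m) ≡ + m
  σₙ-fix {m} m≢n = trans (if-false (<ᵇ-false {n} (<-irrefl refl)))
    (if-false (trans (cong₂ _∧_ (≡ᵇ-true {n} refl) (≡ᵇ-false m≢n)) (∧-zeroʳ true)))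

module _ {n k : ℕ} (1≤k : 1 ≤ k) (k≤n : k ≤ n) where

  σ-fix-below : ∀ {m} → m < k → σ n k (+ m) ≡ + m
  σ-fix-below m<k with m≤n⇒m<n∨m≡n k≤n
  ... | inj₁ k<n = σ-fix k<n (<⇒≢ m<k) (<⇒≢ (m<n⇒m<1+n m<k))
  ... | inj₂ refl = σₙ-fix (<⇒≢ m<k)

  σ-fix-above : ∀ {m} → n < m → σ n k (+ m) ≡ + m
  σ-fix-above n<m with m≤n⇒m<n∨m≡n k≤n
  ... | inj₁ k<n = σ-fix k<n (λ e → <-irrefl (sym e) (<-trans k<n n<m))
                             (λ e → <-irrefl (sym e) (≤-<-trans k<n n<m))
  ... | inj₂ refl = σₙ-fix (λ e → <-irrefl (sym e) n<m)

  σ-odd : ∀ z → σ n k (- z) ≡ - σ n k z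
  σ-odd (+ zero) = trans (σ-fix-below 1≤k) (cong -_ (sym (σ-fix-below 1≤k)))
  σ-odd (+ suc j) = refl
  σ-odd -[1+ j ] = sym (ℤ.neg-involutive _)

  σ-involutive⁺ : ∀ m → σ n k (σ n k (+ m)) ≡ + m
  σ-involutive⁺ m with m≤n⇒m<n∨m≡n k≤n | m ≟ k
  ... | inj₁ k<n | yes refl = trans (cong (σ n k) (σ-up k<n)) (σ-down k<n)
  ... | inj₁ k<n | no m≢k with m ≟ suc k
  ...   | yes refl = trans (cong (σ n k) (σ-down k<n)) (σ-up k<n)
  ...   | no m≢1+k = trans (cong (σ n k) (σ-fix k<n m≢k m≢1+k)) (σ-fix k<n m≢k m≢1+k)
  σ-involutive⁺ m | inj₂ refl | yes refl =
    trans (cong (σ n n) (σₙ-flip {n})) (trans (σ-odd (+ n)) (trans (cong -_ (σₙ-flip {n})) (ℤ.neg-involutive _)))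
  σ-involutive⁺ m | inj₂ refl | no m≢n = trans (cong (σ n n) (σₙ-fix m≢n)) (σₙ-fix m≢n)

  σ-involutive : ∀ z → σ n k (σ n k z) ≡ z
  σ-involutive (+ m) = σ-involutive⁺ m
  σ-involutive -[1+ j ] = trans (σ-odd (σ n k (+ suc j))) (cong -_ (σ-involutive⁺ (suc j)))

  σ-inside : ∀ m → 1 ≤ m → m ≤ n → clip n (σ n k (+ m)) ≡ σ n k (+ m)
  σ-inside m 1≤m m≤n with m≤n⇒m<n∨m≡n k≤n | m ≟ k
  ... | inj₁ k<n | yes refl rewrite σ-up k<n = clip-inside n (suc m) (s≤s z≤n) k<n
  ... | inj₁ k<n | no m≢k with m ≟ suc k
  ...   | yes refl rewrite σ-down k<n = clip-inside n k 1≤k k≤n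
  ...   | no m≢1+k rewrite σ-fix k<n m≢k m≢1+k = clip-inside n m 1≤m m≤n
  σ-inside (suc j) _ _ | inj₂ refl | yes refl rewrite σₙ-flip {suc j} = clip-inside-neg (suc j) j ≤-refl
  σ-inside m 1≤m m≤n | inj₂ refl | no m≢n rewrite σₙ-fix m≢n = clip-inside n m 1≤m m≤n

  clip-σ⁺ : ∀ m → clip n (σ n k (+ m)) ≡ σ n k (clip n (+ m))
  clip-σ⁺ zero rewrite σ-fix-below 1≤k = refl
  clip-σ⁺ (suc j) with suc j ≤? n
  ... | yes 1+j≤n rewrite clip-inside n (suc j) (s≤s z≤n) 1+j≤n = σ-inside (suc j) (s≤s z≤n) 1+j≤n
  ... | no 1+j≰n rewrite clip-outside n (suc j) (≰⇒> 1+j≰n) | σ-fix-above (≰⇒> 1+j≰n)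
    = trans (clip-outside n (suc j) (≰⇒> 1+j≰n)) (sym (σ-fix-below 1≤k))

  clip-σ : ∀ z → clip n (σ n k z) ≡ σ n k (clip n z)
  clip-σ (+ m) = clip-σ⁺ m
  clip-σ -[1+ j ] = begin
    clip n (- σ n k (+ suc j))   ≡⟨ clip-neg n (σ n k (+ suc j)) ⟩
    - clip n (σ n k (+ suc j))   ≡⟨ cong -_ (clip-σ⁺ (suc j)) ⟩
    - σ n k (clip n (+ suc j))   ≡⟨ σ-odd (clip n (+ suc j)) ⟨
    σ n k (- clip n (+ suc j))   ≡⟨ cong (σ n k) (clip-neg n (+ suc j)) ⟨
    σ n k (clip n -[1+ j ])      ∎
    where open ≡-Reasoning

  at-gen : ∀ j → at (gen n k) j ≡ clip n (σ n k (+ suc j))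
  at-gen j with j <ᵇ n in j<n
  ... | true = trans (at-tabulate n (λ m → σ⁺ n k (suc m)) j)
      (trans (if-true j<n) (sym (σ-inside (suc j) (s≤s z≤n) (<ᵇ⇒< j n (subst T (sym j<n) tt)))))
  ... | false = trans (at-tabulate n (λ m → σ⁺ n k (suc m)) j)
      (trans (if-false j<n) (sym (trans (cong (clip n) (σ-fix-above n<1+j)) (clip-outside n (suc j) n<1+j))))
    where
    n<1+j : n < suc j
    n<1+j = ≰⇒> (λ n≤j → subst T j<n (<⇒<ᵇ n≤j))

  act-gen : ∀ z → act (gen n k) z ≡ clip n (σ n k z)
  act-gen (+ zero) rewrite σ-fix-below 1≤k = refl
  act-gen (+ suc j) = at-gen j
  act-gen -[1+ j ] = trans (cong -_ (at-gen j)) (sym (clip-neg n (σ n k (+ suc j))))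

module _ {n k l : ℕ} (k+2≤l : suc (suc k) ≤ l) where
  private
    k<l : k < l
    k<l = ≤-trans (n≤1+n _) k+2≤l
    k≢l : k ≢ l
    k≢l = <⇒≢ k<l
    k≢1+l : k ≢ suc l
    k≢1+l = <⇒≢ (m<n⇒m<1+n k<l)
    1+k≢l : suc k ≢ l
    1+k≢l = <⇒≢ k+2≤l
    1+k≢1+l : suc k ≢ suc l
    1+k≢1+l = <⇒≢ (m<n⇒m<1+n k+2≤l)

  module _ (l<n : l < n) where
    private
      k<n : k < n
      k<n = <-trans k<l l<n

    σ-comm-transposition : ∀ m → σ n k (σ n l (+ m)) ≡ σ n l (σ n k (+ m))
    σ-comm-transposition m with m ≟ k | m ≟ suc k | m ≟ l | m ≟ suc l
    ... | yes refl | _ | _ | _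
        rewrite σ-fix l<n k≢l k≢1+l | σ-up k<n = sym (σ-fix l<n 1+k≢l 1+k≢1+l)
    ... | no _ | yes refl | _ | _
        rewrite σ-fix l<n 1+k≢l 1+k≢1+l | σ-down k<n = sym (σ-fix l<n k≢l k≢1+l)
    ... | no _ | no _ | yes refl | _
        rewrite σ-up l<n | σ-fix k<n (≢-sym k≢1+l) (≢-sym 1+k≢1+l)
              | σ-fix k<n (≢-sym k≢l) (≢-sym 1+k≢l) | σ-up l<n = refl
    ... | no _ | no _ | no _ | yes refl
        rewrite σ-down l<n | σ-fix k<n (≢-sym k≢l) (≢-sym 1+k≢l)
              | σ-fix k<n (≢-sym k≢1+l) (≢-sym 1+k≢1+l) | σ-down l<n = refl
    ... | no m≢k | no m≢1+k | no m≢l | no m≢1+l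
        rewrite σ-fix l<n m≢l m≢1+l | σ-fix k<n m≢k m≢1+k = sym (σ-fix l<n m≢l m≢1+l)

  σ-comm-sign : 1 ≤ k → ∀ m → σ l k (σ l l (+ m)) ≡ σ l l (σ l k (+ m))
  σ-comm-sign 1≤k m with m ≟ k | m ≟ suc k | m ≟ l
  ... | yes refl | _ | _ rewrite σₙ-fix {l} k≢l | σ-up k<l = sym (σₙ-fix 1+k≢l)
  ... | no _ | yes refl | _ rewrite σₙ-fix {l} 1+k≢l | σ-down k<l = sym (σₙ-fix k≢l)
  ... | no m≢k | no m≢1+k | yes refl = begin
    σ l k (σ l l (+ l))   ≡⟨ cong (σ l k) (σₙ-flip {l}) ⟩
    σ l k (- (+ l))       ≡⟨ σ-odd 1≤k (<⇒≤ k<l) (+ l) ⟩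
    - σ l k (+ l)         ≡⟨ cong -_ (σ-fix k<l m≢k m≢1+k) ⟩
    - (+ l)               ≡⟨ σₙ-flip {l} ⟨
    σ l l (+ l)           ≡⟨ cong (σ l l) (σ-fix k<l m≢k m≢1+k) ⟨
    σ l l (σ l k (+ l))   ∎
    where open ≡-Reasoning
  ... | no m≢k | no m≢1+k | no m≢l
      rewrite σₙ-fix {l} m≢l | σ-fix k<l m≢k m≢1+k = sym (σₙ-fix m≢l)

σ-comm : ∀ {n k l} → 1 ≤ k → suc (suc k) ≤ l → l ≤ n → ∀ z → σ n k (σ n l z) ≡ σ n l (σ n k z)
σ-comm {n} {k} {l} 1≤k k+2≤l l≤n = on-ℤ
  where
  on-ℕ : ∀ m → σ n k (σ n l (+ m)) ≡ σ n l (σ n k (+ m))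
  on-ℕ with m≤n⇒m<n∨m≡n l≤n
  ... | inj₁ l<n = σ-comm-transposition k+2≤l l<n
  ... | inj₂ refl = σ-comm-sign {n} k+2≤l 1≤k
  k≤l : k ≤ l
  k≤l = ≤-trans (n≤1+n _) (≤-trans (n≤1+n _) k+2≤l)
  on-ℤ : ∀ z → σ n k (σ n l z) ≡ σ n l (σ n k z)
  on-ℤ (+ m) = on-ℕ m
  on-ℤ -[1+ j ] = begin
    σ n k (- σ n l (+ suc j))   ≡⟨ σ-odd 1≤k (≤-trans k≤l l≤n) (σ n l (+ suc j)) ⟩
    - σ n k (σ n l (+ suc j))   ≡⟨ cong -_ (on-ℕ (suc j)) ⟩
    - σ n l (σ n k (+ suc j))   ≡⟨ σ-odd (≤-trans 1≤k k≤l) l≤n (σ n k (+ suc j)) ⟨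
    σ n l (- σ n k (+ suc j))   ∎
    where open ≡-Reasoning

σₙ-fix-ℤ : ∀ {n} z → z ≢ + n → z ≢ - (+ n) → σ n n z ≡ z
σₙ-fix-ℤ (+ m) z≢n _ = σₙ-fix (λ m≡n → z≢n (cong +_ m≡n))
σₙ-fix-ℤ -[1+ j ] _ z≢-n = cong -_ (σₙ-fix (λ 1+j≡n → z≢-n (cong (λ t → - (+ t)) 1+j≡n)))

σₙ-comm : ∀ {n} → 1 ≤ n → (g : ℤ → ℤ) → (∀ z → g (- z) ≡ - g z) → (∀ u v → g u ≡ g v → u ≡ v) →
  g (+ n) ≡ + n → ∀ z → σ n n (g z) ≡ g (σ n n z)
σₙ-comm {n} 1≤n g odd injective fixes z with z ℤ.≟ + n | z ℤ.≟ - (+ n)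
... | yes refl | _ = begin
  σ n n (g (+ n))   ≡⟨ cong (σ n n) fixes ⟩
  σ n n (+ n)       ≡⟨ σₙ-flip ⟩
  - (+ n)           ≡⟨ cong -_ fixes ⟨
  - g (+ n)         ≡⟨ odd (+ n) ⟨
  g (- (+ n))       ≡⟨ cong g σₙ-flip ⟨
  g (σ n n (+ n))   ∎
  where open ≡-Reasoning
... | no _ | yes refl = begin
  σ n n (g (- (+ n)))   ≡⟨ cong (σ n n) (trans (odd (+ n)) (cong -_ fixes)) ⟩
  σ n n (- (+ n))       ≡⟨ σ-unflip ⟩
  + n                   ≡⟨ fixes ⟨
  g (+ n)               ≡⟨ cong g σ-unflip ⟨
  g (σ n n (- (+ n)))   ∎
  where
  open ≡-Reasoning
  σ-unflip : σ n n (- (+ n)) ≡ + n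
  σ-unflip = trans (σ-odd 1≤n ≤-refl (+ n)) (trans (cong -_ σₙ-flip) (ℤ.neg-involutive _))
... | no z≢n | no z≢-n =
  trans (σₙ-fix-ℤ (g z) (λ e → z≢n (injective _ _ (trans e (sym fixes))))
                        (λ e → z≢-n (injective _ _ (trans e (sym (trans (odd (+ n)) (cong -_ fixes)))))))
        (cong g (sym (σₙ-fix-ℤ z z≢n z≢-n)))

-- Boxes and the order of Q in coordinates

module _ {n : ℕ} where

  row≥1 : (a : Box n) → 1 ≤ r a
  row≥1 (box ρ κ p _ _ _) = recompute (1 ≤? ρ) p

  row≤n : (a : Box n) → r a ≤ n
  row≤n (box ρ κ _ p _ _) = recompute (ρ ≤? n) p

  col≥1 : (a : Box n) → 1 ≤ c a
  col≥1 (box ρ κ _ _ p _) = recompute (1 ≤? κ) p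

  col≤ : (a : Box n) → c a ≤ n ∸ r a + 1
  col≤ (box ρ κ _ _ _ p) = recompute (κ ≤? n ∸ ρ + 1) p

  row+maxCol : (a : Box n) → r a + (n ∸ r a + 1) ≡ suc n
  row+maxCol a = begin
    r a + (n ∸ r a + 1)   ≡⟨ +-assoc (r a) (n ∸ r a) 1 ⟨
    r a + (n ∸ r a) + 1   ≡⟨ cong (_+ 1) (m+[n∸m]≡n (row≤n a)) ⟩
    n + 1                 ≡⟨ +-comm n 1 ⟩
    suc n                 ∎
    where open ≡-Reasoning

  row+col≤ : (a : Box n) → r a + c a ≤ suc n
  row+col≤ a = ≤-trans (+-monoʳ-≤ (r a) (col≤ a)) (≤-reflexive (row+maxCol a))

  diagonal⇒row+col : (a : Box n) → Diagonal a → r a + c a ≡ suc n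
  diagonal⇒row+col a diag = trans (cong (λ t → r a + t) diag) (row+maxCol a)

  boxAt : ∀ ρ κ → 1 ≤ ρ → ρ ≤ n → 1 ≤ κ → ρ + κ ≤ suc n → Box n
  boxAt ρ κ 1≤ρ ρ≤n 1≤κ ρ+κ≤ = box ρ κ 1≤ρ ρ≤n 1≤κ (begin
    κ                ≡⟨ m+n∸m≡n ρ κ ⟨
    ρ + κ ∸ ρ        ≤⟨ ∸-monoˡ-≤ ρ ρ+κ≤ ⟩
    suc n ∸ ρ        ≡⟨ cong (_∸ ρ) (+-comm 1 n) ⟩
    n + 1 ∸ ρ        ≡⟨ +-∸-comm 1 ρ≤n ⟩
    n ∸ ρ + 1        ∎)
    where open ≤-Reasoning

  Box-≡ : ∀ (a b : Box n) → r a ≡ r b → c a ≡ c b → a ≡ b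
  Box-≡ (box ρ κ _ _ _ _) (box .ρ .κ _ _ _ _) refl refl = refl

  CoordLess : Box n → Box n → Set
  CoordLess a b = r b ≤ r a × c a ≤ c b × (r b < r a ⊎ c a < c b)

  ⋖⇒coord : ∀ {a b : Box n} → a ⋖ b → CoordLess a b
  ⋖⇒coord (inj₁ (refl , refl)) = ≤-refl , n≤1+n _ , inj₂ ≤-refl
  ⋖⇒coord (inj₂ (refl , refl)) = n≤1+n _ , ≤-refl , inj₁ ≤-refl

  coord-trans : ∀ {a b d : Box n} → CoordLess a b → CoordLess b d → CoordLess a d
  coord-trans (rb≤ra , ca≤cb , inj₁ rb<ra) (rd≤rb , cb≤cd , _) =
    ≤-trans rd≤rb rb≤ra , ≤-trans ca≤cb cb≤cd , inj₁ (≤-<-trans rd≤rb rb<ra)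
  coord-trans (rb≤ra , ca≤cb , inj₂ ca<cb) (rd≤rb , cb≤cd , _) =
    ≤-trans rd≤rb rb≤ra , ≤-trans ca≤cb cb≤cd , inj₂ (<-≤-trans ca<cb cb≤cd)

  <Q⇒coord : ∀ {a b : Box n} → a <Q b → CoordLess a b
  <Q⇒coord {a} {b} [ a⋖b ] = ⋖⇒coord {a} {b} a⋖b
  <Q⇒coord {a} {b} (_∷_ {y = m} a⋖m m<b) = coord-trans {a} {m} {b} (⋖⇒coord {a} {m} a⋖m) (<Q⇒coord m<b)

  <Q-irrefl : ∀ {a : Box n} → ¬ (a <Q a)
  <Q-irrefl a<a with <Q⇒coord a<a
  ... | _ , _ , inj₁ ra<ra = <-irrefl refl ra<ra
  ... | _ , _ , inj₂ ca<ca = <-irrefl refl ca<ca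

  <Q-trans : ∀ {a b d : Box n} → a <Q b → b <Q d → a <Q d
  <Q-trans [ a⋖b ] b<d = a⋖b ∷ b<d
  <Q-trans (a⋖m ∷ m<b) b<d = a⋖m ∷ <Q-trans m<b b<d

  <Q-along-row : ∀ d (a b : Box n) → r a ≡ r b → c b ≡ suc d + c a → a <Q b
  <Q-along-row zero a b ra≡rb cb≡ = [ inj₁ (sym ra≡rb , cb≡) ]
  <Q-along-row (suc d) a b ra≡rb cb≡ =
    inj₁ (refl , refl) ∷ <Q-along-row d next b ra≡rb (trans cb≡ (sym (+-suc (suc d) (c a))))
    where
    next : Box n
    next = boxAt (r a) (suc (c a)) (row≥1 a) (row≤n a) (s≤s z≤n) (begin
      r a + suc (c a)   ≤⟨ +-monoʳ-≤ (r a) (≤-trans (s≤s (m≤n+m (c a) (suc d))) (≤-reflexive (sym cb≡))) ⟩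
      r a + c b         ≡⟨ cong (_+ c b) ra≡rb ⟩
      r b + c b         ≤⟨ row+col≤ b ⟩
      suc n             ∎)
      where open ≤-Reasoning

  <Q-along-column : ∀ d (a b : Box n) → c a ≡ c b → r a ≡ suc d + r b → a <Q b
  <Q-along-column zero a b ca≡cb ra≡ = [ inj₂ (sym ra≡ , sym ca≡cb) ]
  <Q-along-column (suc d) a b ca≡cb ra≡ = inj₂ (sym ra≡ , refl) ∷ <Q-along-column d next b ca≡cb refl
    where
    next : Box n
    next = boxAt (suc d + r b) (c a) (s≤s z≤n) (≤-trans (n≤1+n _) (subst (_≤ n) ra≡ (row≤n a))) (col≥1 a)
      (≤-trans (+-monoˡ-≤ (c a) (subst (suc d + r b ≤_) (sym ra≡) (n≤1+n _))) (row+col≤ a))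

  coord⇒<Q : ∀ (a b : Box n) → CoordLess a b → a <Q b
  coord⇒<Q a b (rb≤ra , ca≤cb , strict) = go (m≤n⇒m<n∨m≡n rb≤ra) (m≤n⇒m<n∨m≡n ca≤cb) strict
    where
    corner : Box n
    corner = boxAt (r b) (c a) (row≥1 b) (row≤n b) (col≥1 a) (≤-trans (+-monoʳ-≤ (r b) ca≤cb) (row+col≤ b))
    up : r b < r a → a <Q corner
    up rb<ra = <Q-along-column (r a ∸ suc (r b)) a corner refl
      (sym (trans (sym (+-suc (r a ∸ suc (r b)) (r b))) (m∸n+n≡m rb<ra)))
    right : c a < c b → corner <Q b
    right ca<cb = <Q-along-row (c b ∸ suc (c a)) corner b refl
      (sym (trans (sym (+-suc (c b ∸ suc (c a)) (c a))) (m∸n+n≡m ca<cb)))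
    go : r b < r a ⊎ r b ≡ r a → c a < c b ⊎ c a ≡ c b → r b < r a ⊎ c a < c b → a <Q b
    go (inj₁ rb<ra) (inj₁ ca<cb) _ = <Q-trans (up rb<ra) (right ca<cb)
    go (inj₁ rb<ra) (inj₂ ca≡cb) _ = subst (a <Q_) (Box-≡ corner b refl ca≡cb) (up rb<ra)
    go (inj₂ rb≡ra) (inj₁ ca<cb) _ = subst (_<Q b) (Box-≡ corner a rb≡ra refl) (right ca<cb)
    go (inj₂ rb≡ra) (inj₂ _) (inj₁ rb<ra) = ⊥-elim (<-irrefl rb≡ra rb<ra)
    go (inj₂ _) (inj₂ ca≡cb) (inj₂ ca<cb) = ⊥-elim (<-irrefl ca≡cb ca<cb)

  ≮Q⇒coord : ∀ (a b : Box n) → a ≢ b → ¬ (a <Q b) → r a < r b ⊎ c b < c a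
  ≮Q⇒coord a b a≢b a≮b with r b ≤? r a | c a ≤? c b
  ... | no rb≰ra | _ = inj₁ (≰⇒> rb≰ra)
  ... | yes _ | no ca≰cb = inj₂ (≰⇒> ca≰cb)
  ... | yes rb≤ra | yes ca≤cb with r b <? r a | c a <? c b
  ...   | yes rb<ra | _ = ⊥-elim (a≮b (coord⇒<Q a b (rb≤ra , ca≤cb , inj₁ rb<ra)))
  ...   | no _ | yes ca<cb = ⊥-elim (a≮b (coord⇒<Q a b (rb≤ra , ca≤cb , inj₂ ca<cb)))
  ...   | no rb≮ra | no ca≮cb =
    ⊥-elim (a≢b (Box-≡ a b (≤-antisym (≮⇒≥ rb≮ra) rb≤ra) (≤-antisym ca≤cb (≮⇒≥ ca≮cb))))

  incomparable⇒coord : ∀ (a b : Box n) → a ≢ b → ¬ (a <Q b) → ¬ (b <Q a) →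
    (r a < r b × c a < c b) ⊎ (r b < r a × c b < c a)
  incomparable⇒coord a b a≢b a≮b b≮a with ≮Q⇒coord a b a≢b a≮b | ≮Q⇒coord b a (≢-sym a≢b) b≮a
  ... | inj₁ ra<rb | inj₁ rb<ra = ⊥-elim (<-asym ra<rb rb<ra)
  ... | inj₁ ra<rb | inj₂ ca<cb = inj₁ (ra<rb , ca<cb)
  ... | inj₂ cb<ca | inj₁ rb<ra = inj₂ (rb<ra , cb<ca)
  ... | inj₂ cb<ca | inj₂ ca<cb = ⊥-elim (<-asym cb<ca ca<cb)

  suc-label : (a : Box n) → suc (label a) ≡ r a + c a
  suc-label a with r a | row≥1 a
  ... | suc ρ | _ = refl

  label≥1 : (a : Box n) → 1 ≤ label a
  label≥1 a = ≤-pred (subst (2 ≤_) (sym (suc-label a)) (+-mono-≤ (row≥1 a) (col≥1 a)))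

  label≤n : (a : Box n) → label a ≤ n
  label≤n a = ≤-pred (subst (_≤ suc n) (sym (suc-label a)) (row+col≤ a))

  label≡ : ∀ (a : Box n) {k} → r a + c a ≡ suc k → label a ≡ k
  label≡ a sum≡ = suc-injective (trans (suc-label a) sum≡)

  label-gap : (a b : Box n) → r a < r b → c a < c b → suc (suc (label a)) ≤ label b
  label-gap a b ra<rb ca<cb = ≤-pred (subst₂ _≤_ (cong (λ t → suc (suc t)) (sym (suc-label a))) (sym (suc-label b))
    (subst (_≤ r b + c b) (cong suc (+-suc (r a) (c a))) (+-mono-≤ ra<rb ca<cb)))

-- Letters of a filling as maps on ℤ

byFill : Fill → (ℤ → ℤ) → ℤ → ℤ
byFill f0 s = s
byFill f+ _ z = z

module _ {n : ℕ} where

  τ : (Box n → Fill) → Box n → ℤ → ℤ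
  τ F b = byFill (F b) (σ n (label b))

  act-letter : ∀ F b z → act (letter F b) z ≡ clip n (τ F b z)
  act-letter F b z with F b
  ... | f0 = act-gen (label≥1 b) (label≤n b) z
  ... | f+ = act-id n z

  τ-clip : ∀ F b z → τ F b (clip n z) ≡ clip n (τ F b z)
  τ-clip F b z with F b
  ... | f0 = sym (clip-σ (label≥1 b) (label≤n b) z)
  ... | f+ = refl

  τ-odd : ∀ F b z → τ F b (- z) ≡ - τ F b z
  τ-odd F b z with F b
  ... | f0 = σ-odd (label≥1 b) (label≤n b) z
  ... | f+ = refl

  τ-involutive : ∀ F b z → τ F b (τ F b z) ≡ z
  τ-involutive F b z with F b
  ... | f0 = σ-involutive (label≥1 b) (label≤n b) z
  ... | f+ = refl

  τ-fix-below : ∀ F b v → v < label b → τ F b (+ v) ≡ + v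
  τ-fix-below F b v v<label with F b
  ... | f0 = σ-fix-below (label≥1 b) (label≤n b) v<label
  ... | f+ = refl

  τ-incomparable : ∀ F a b → a ≢ b → ¬ a <Q b → ¬ b <Q a → ∀ z → τ F a (τ F b z) ≡ τ F b (τ F a z)
  τ-incomparable F a b a≢b a≮b b≮a z with F a | F b
  ... | f+ | _ = refl
  ... | f0 | f+ = refl
  ... | f0 | f0 with incomparable⇒coord a b a≢b a≮b b≮a
  ...   | inj₁ (ra<rb , ca<cb) = σ-comm (label≥1 a) (label-gap a b ra<rb ca<cb) (label≤n b) z
  ...   | inj₂ (rb<ra , cb<ca) = sym (σ-comm (label≥1 b) (label-gap b a rb<ra cb<ca) (label≤n a) z)

  applyAll-clip : ∀ F L z → applyAll (τ F) L (clip n z) ≡ clip n (applyAll (τ F) L z)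
  applyAll-clip F [] z = refl
  applyAll-clip F (b ∷ L) z = trans (cong (applyAll (τ F) L) (τ-clip F b z)) (applyAll-clip F L (τ F b z))

  applyAll-odd : ∀ F L z → applyAll (τ F) L (- z) ≡ - applyAll (τ F) L z
  applyAll-odd F [] z = refl
  applyAll-odd F (b ∷ L) z = trans (cong (applyAll (τ F) L) (τ-odd F b z)) (applyAll-odd F L (τ F b z))

  applyAll-injective : ∀ F L u v → applyAll (τ F) L u ≡ applyAll (τ F) L v → u ≡ v
  applyAll-injective F [] u v eq = eq
  applyAll-injective F (b ∷ L) u v eq = begin
    u                   ≡⟨ τ-involutive F b u ⟨
    τ F b (τ F b u)     ≡⟨ cong (τ F b) (applyAll-injective F L _ _ eq) ⟩
    τ F b (τ F b v)     ≡⟨ τ-involutive F b v ⟩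
    v                   ∎
    where open ≡-Reasoning

  applyAll-agree : ∀ F G L → All (λ b → F b ≡ G b) L → ∀ z → applyAll (τ F) L z ≡ applyAll (τ G) L z
  applyAll-agree F G [] _ z = refl
  applyAll-agree F G (b ∷ L) (Fb≡Gb ∷ agree) z =
    trans (cong (λ f → applyAll (τ F) L (byFill f (σ n (label b)) z)) Fb≡Gb) (applyAll-agree F G L agree _)

  act-vList : ∀ F L z → act (vList F L) z ≡ clip n (applyAll (τ F) L z)
  act-vList F [] z = act-id n z
  act-vList F (b ∷ L) z = begin
    act (vList F L · letter F b) z                  ≡⟨ act-· (vList F L) (letter F b) z ⟩
    act (vList F L) (act (letter F b) z)            ≡⟨ act-vList F L _ ⟩
    clip n (applyAll (τ F) L (act (letter F b) z))  ≡⟨ cong (λ t → clip n (applyAll (τ F) L t)) (act-letter F b z) ⟩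
    clip n (applyAll (τ F) L (clip n (τ F b z)))    ≡⟨ cong (clip n) (applyAll-clip F L (τ F b z)) ⟩
    clip n (clip n (applyAll (τ F) L (τ F b z)))    ≡⟨ clip-idem n (applyAll (τ F) L (τ F b z)) ⟩
    clip n (applyAll (τ F) (b ∷ L) z)               ∎
    where open ≡-Reasoning

  vList-≡ : ∀ F G L₁ L₂ → (∀ z → applyAll (τ F) L₁ z ≡ applyAll (τ G) L₂ z) → vList F L₁ ≡ vList G L₂
  vList-≡ F G L₁ L₂ same = act-injective _ _ (λ z →
    trans (act-vList F L₁ z) (trans (cong (clip n) (same z)) (sym (act-vList G L₂ z))))

  τ-zero : ∀ F b {k} → F b ≡ f0 → label b ≡ k → ∀ z → τ F b z ≡ σ n k z
  τ-zero F b Fb≡f0 refl z = cong (λ f → byFill f (σ n (label b)) z) Fb≡f0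

  τ-plus : ∀ F b → F b ≡ f+ → ∀ z → τ F b z ≡ z
  τ-plus F b Fb≡f+ z = cong (λ f → byFill f (σ n (label b)) z) Fb≡f+

  τ-fix-beyond : ∀ F b ρ κ → ρ < r b → κ < c b → τ F b (+ (ρ + κ)) ≡ + (ρ + κ)
  τ-fix-beyond F b ρ κ ρ<rb κ<cb = τ-fix-below F b (ρ + κ) (≤-pred (begin
    suc (suc (ρ + κ))   ≡⟨ cong suc (+-suc ρ κ) ⟨
    suc ρ + suc κ       ≤⟨ +-mono-≤ ρ<rb κ<cb ⟩
    r b + c b           ≡⟨ suc-label b ⟨
    suc (label b)       ∎))
    where open ≤-Reasoning

∧-false : ∀ {u v} → u ≡ false ⊎ v ≡ false → (u ∧ v) ≡ false
∧-false {u} (inj₁ refl) = refl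
∧-false {u} (inj₂ refl) = ∧-zeroʳ u

module _ {n : ℕ} where

  =ᵇ-false : ∀ (a b : Box n) → r a ≢ r b ⊎ c a ≢ c b → (a =ᵇ b) ≡ false
  =ᵇ-false a b (inj₁ ra≢rb) = ∧-false (inj₁ (≡ᵇ-false ra≢rb))
  =ᵇ-false a b (inj₂ ca≢cb) = ∧-false {r a ≡ᵇ r b} (inj₂ (≡ᵇ-false ca≢cb))

  ∪at-here : ∀ (D : Box n → Fill) a → (D ∪at a) a ≡ f0
  ∪at-here D a = if-true (cong₂ _∧_ (≡ᵇ-true {r a} refl) (≡ᵇ-true {c a} refl))

  ∪at-elsewhere : ∀ (D : Box n → Fill) a b → r b ≢ r a ⊎ c b ≢ c a → (D ∪at a) b ≡ D b
  ∪at-elsewhere D a b off = if-false (=ᵇ-false b a off)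

  S₁-corner : ∀ (x y b : Box n) → r b ≡ r y → c b ≡ c x → S₁ x y b ≡ s+
  S₁-corner x y b rb≡ry cb≡cx = if-true (cong₂ _∧_ (≡ᵇ-true rb≡ry) (≡ᵇ-true cb≡cx))

  S₁-elsewhere : ∀ (x y b : Box n) → r b ≢ r y ⊎ c b ≢ c x → S₁ x y b ≡ s0
  S₁-elsewhere x y b (inj₁ rb≢ry) = if-false (∧-false (inj₁ (≡ᵇ-false rb≢ry)))
  S₁-elsewhere x y b (inj₂ cb≢cx) = if-false (∧-false {r b ≡ᵇ r y} (inj₂ (≡ᵇ-false cb≢cx)))

-- Linear extensions of [x, y) and (x, y]

record OpenLinExt {n} (x y : Box n) (L : List (Box n)) : Set where
  field
    unique : Unique L
    ordered : Ordered _<Q_ L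
    inside : All (Open x y) L
    complete : ∀ {d} → Open x y d → d ∈ L

module _ {n : ℕ} {x y : Box n} (x<y : x <Q y) where

  halfL-linExt : ∀ {L₁} → IsLinExt (HalfL x y) L₁ → Σ (List (Box n)) λ L → L₁ ≡ x ∷ L × OpenLinExt x y L
  halfL-linExt {[]} (_ , _ , complete₁ , _) with complete₁ x (inj₁ refl , x<y)
  ... | ()
  halfL-linExt {h ∷ L} (inHalf ∷ insideL , h∉L ∷ uniqueL , complete₁ , index<) =
    L , cong (_∷ L) h≡x , record
      { unique = uniqueL
      ; ordered = AllPairs.tail ordered₁
      ; inside = All.zipWith open-tail (h∉L , insideL)
      ; complete = λ {d} od → complete-tail (complete₁ d (inj₂ (proj₁ od) , proj₂ od)) (proj₁ od) }
    where
    ordered₁ : Ordered _<Q_ (h ∷ L)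
    ordered₁ = linExt-ordered (h ∷ L) index<
    h≡x : h ≡ x
    h≡x with proj₁ inHalf
    ... | inj₁ x≡h = sym x≡h
    ... | inj₂ x<h with complete₁ x (inj₁ refl , x<y)
    ...   | here x≡h = ⊥-elim (<Q-irrefl (subst (_<Q h) x≡h x<h))
    ...   | there x∈L = ⊥-elim (All.lookup (AllPairs.head ordered₁) x∈L x<h)
    open-tail : ∀ {l} → h ≢ l × HalfL x y l → Open x y l
    open-tail (h≢l , inj₁ x≡l , l<y) = ⊥-elim (h≢l (trans h≡x x≡l))
    open-tail (_ , inj₂ x<l , l<y) = x<l , l<y
    complete-tail : ∀ {d} → d ∈ h ∷ L → x <Q d → d ∈ L
    complete-tail (here refl) x<h = ⊥-elim (<Q-irrefl (subst (x <Q_) h≡x x<h))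
    complete-tail (there d∈L) _ = d∈L

  module _ {L L₂ : List (Box n)} (ext : OpenLinExt x y L) (ext₂ : IsLinExt (HalfR x y) L₂) where
    open OpenLinExt ext

    complete₂ : ∀ b → HalfR x y b → b ∈ L₂
    complete₂ = proj₁ (proj₂ (proj₂ ext₂))

    halfR⊆ : ∀ {b} → b ∈ L₂ → b ∈ L ∷ʳ y
    halfR⊆ b∈L₂ with All.lookup (proj₁ ext₂) b∈L₂
    ... | _ , inj₁ refl = ∈-++⁺ʳ L (here refl)
    ... | x<b , inj₂ b<y = ∈-++⁺ˡ (complete (x<b , b<y))

    ⊆halfR : ∀ {b} → b ∈ L ∷ʳ y → b ∈ L₂
    ⊆halfR {b} b∈ with ∈-++⁻ L b∈
    ... | inj₁ b∈L = complete₂ b (proj₁ (All.lookup inside b∈L) , inj₂ (proj₂ (All.lookup inside b∈L)))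
    ... | inj₂ (here refl) = complete₂ y (x<y , inj₁ refl)

    snoc-unique : Unique (L ∷ʳ y)
    snoc-unique = Unique.++⁺ unique ([] ∷ []) λ { (v∈L , here refl) → <Q-irrefl (proj₂ (All.lookup inside v∈L)) }

    snoc-ordered : Ordered _<Q_ (L ∷ʳ y)
    snoc-ordered = AllPairs.++⁺ ordered ([] ∷ [])
      (All.map (λ (_ , l<y) → (λ y<l → <Q-irrefl (<Q-trans l<y y<l)) ∷ []) inside)

-- Tracking n through the hook of the interval (x, y)

-- l is not weakly below the position (ρ, κ) of Q.
Beyond : ∀ {n} → ℕ → ℕ → Box n → Set
Beyond ρ κ l = r l < ρ ⊎ κ < c l

HasBoxAt : ∀ {n} → List (Box n) → ℕ → ℕ → Set
HasBoxAt L ρ κ = Any (λ l → r l ≡ ρ × c l ≡ κ) L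

module Hook {n : ℕ} (x y : Box n) (D : Box n → Fill)
  (x-diag : r x + c x ≡ suc n) (y-diag : r y + c y ≡ suc n) (x<y : x <Q y)
  (compatible : Compatible x y (S₁ x y) D) where

  F : Box n → Fill
  F = D ∪at x

  ry<rx×cx<cy : r y < r x × c x < c y
  ry<rx×cx<cy with <Q⇒coord x<y
  ... | _ , _ , inj₁ ry<rx = ry<rx , +-cancelˡ-< (r y) (c x) (c y)
    (subst (r y + c x <_) (trans x-diag (sym y-diag)) (+-monoˡ-< (c x) ry<rx))
  ... | _ , _ , inj₂ cx<cy = +-cancelʳ-< (c x) (r y) (r x)
    (subst (r y + c x <_) (trans y-diag (sym x-diag)) (+-monoʳ-< (r y) cx<cy)) , cx<cy

  ry<rx : r y < r x
  ry<rx = proj₁ ry<rx×cx<cy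

  cx<cy : c x < c y
  cx<cy = proj₂ ry<rx×cx<cy

  record Between (b : Box n) : Set where
    field
      ry≤rb : r y ≤ r b
      rb≤rx : r b ≤ r x
      cx≤cb : c x ≤ c b
      x-strict : r b < r x ⊎ c x < c b
      y-strict : r y < r b ⊎ c b < c y

  between : ∀ {b} → Open x y b → Between b
  between (x<b , b<y) with <Q⇒coord x<b | <Q⇒coord b<y
  ... | rb≤rx , cx≤cb , x-strict | ry≤rb , _ , y-strict = record
    { ry≤rb = ry≤rb ; rb≤rx = rb≤rx ; cx≤cb = cx≤cb ; x-strict = x-strict ; y-strict = y-strict }

  F≡D : ∀ {b} → Open x y b → F b ≡ D b
  F≡D {b} ob with Between.x-strict (between ob)
  ... | inj₁ rb<rx = ∪at-elsewhere D x b (inj₁ (<⇒≢ rb<rx))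
  ... | inj₂ cx<cb = ∪at-elsewhere D x b (inj₂ (≢-sym (<⇒≢ cx<cb)))

  D∪y≡D : ∀ {b} → Open x y b → (D ∪at y) b ≡ D b
  D∪y≡D {b} ob with Between.y-strict (between ob)
  ... | inj₁ ry<rb = ∪at-elsewhere D y b (inj₁ (≢-sym (<⇒≢ ry<rb)))
  ... | inj₂ cb<cy = ∪at-elsewhere D y b (inj₂ (<⇒≢ cb<cy))

  F-corner : ∀ {b} → Open x y b → r b ≡ r y → c b ≡ c x → F b ≡ f+
  F-corner {b} ob rb≡ry cb≡cx = trans (F≡D ob) (proj₂ (compatible b ob) (S₁-corner x y b rb≡ry cb≡cx))

  F-elsewhere : ∀ {b} → Open x y b → r b ≢ r y ⊎ c b ≢ c x → F b ≡ f0
  F-elsewhere {b} ob off = trans (F≡D ob) (proj₁ (compatible b ob) (S₁-elsewhere x y b off))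

  -- What remains of a linear extension of (x, y) once a down-set of it has been applied.
  record Suffix (L : List (Box n)) : Set where
    field
      unique : Unique L
      ordered : Ordered _<Q_ L
      inside : All (Open x y) L
      closed : ∀ d → Open x y d → d ∈ L ⊎ All (λ l → ¬ l <Q d) L

  module _ {b : Box n} {L : List (Box n)} (s : Suffix (b ∷ L)) where
    open Suffix s

    head-inside : Open x y b
    head-inside = All.head inside

    Suffix-tail : Suffix L
    Suffix-tail = record
      { unique = AllPairs.tail unique
      ; ordered = AllPairs.tail ordered
      ; inside = All.tail inside
      ; closed = λ d od → after (closed d od) }
      where
      after : ∀ {d} → d ∈ b ∷ L ⊎ All (λ l → ¬ l <Q d) (b ∷ L) → d ∈ L ⊎ All (λ l → ¬ l <Q d) L
      after (inj₁ (here refl)) = inj₂ (AllPairs.head ordered)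
      after (inj₁ (there d∈L)) = inj₁ d∈L
      after (inj₂ (_ ∷ below)) = inj₂ below

    after-head : All (Beyond (r b) (c b)) L
    after-head = All.zipWith (λ (l≢b , l≮b) → ≮Q⇒coord _ b l≢b l≮b)
      (All.map ≢-sym (AllPairs.head unique) , AllPairs.head ordered)

    after-box : ∀ {ρ κ} → r b ≡ ρ → c b ≡ κ → All (Beyond ρ κ) L
    after-box refl refl = after-head

    before-box : ∀ {ρ κ} → HasBoxAt L ρ κ → ρ < r b ⊎ c b < κ
    before-box {ρ} {κ} at with All.lookupAny after-head at
    ... | beyond , (rl≡ρ , cl≡κ) = subst₂ (λ ρ' κ' → ρ' < r b ⊎ c b < κ') rl≡ρ cl≡κ beyond

    successor-in-tail : ∀ d → Open x y d → b <Q d → HasBoxAt L (r d) (c d)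
    successor-in-tail d od b<d with closed d od
    ... | inj₁ (here refl) = ⊥-elim (<Q-irrefl b<d)
    ... | inj₁ (there d∈L) = Any.map (λ { refl → refl , refl }) d∈L
    ... | inj₂ (b≮d ∷ _) = ⊥-elim (b≮d b<d)

  module _ {p : ℕ} (ry≤p : r y ≤ p) (p<rx : p < r x) where

    columnBox : Box n
    columnBox = boxAt p (c x) (≤-trans (row≥1 y) ry≤p) (≤-trans (<⇒≤ p<rx) (row≤n x)) (col≥1 x)
      (≤-trans (+-monoˡ-≤ (c x) (<⇒≤ p<rx)) (≤-reflexive x-diag))

    columnBox-inside : Open x y columnBox
    columnBox-inside = coord⇒<Q x columnBox (<⇒≤ p<rx , ≤-refl , inj₁ p<rx) ,
                       coord⇒<Q columnBox y (ry≤p , <⇒≤ cx<cy , inj₂ cx<cy)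

  column-successor : ∀ {b L p} → Suffix (b ∷ L) → r b ≡ suc p → c b ≡ c x → r y ≤ p →
    HasBoxAt L p (c x)
  column-successor {b} {L} {p} s rb≡1+p cb≡cx ry≤p =
    successor-in-tail s (columnBox ry≤p p<rx) (columnBox-inside ry≤p p<rx)
      (coord⇒<Q b _ (<⇒≤ p<rb , ≤-reflexive cb≡cx , inj₁ p<rb))
    where
    p<rb : p < r b
    p<rb = ≤-reflexive (sym rb≡1+p)
    p<rx : p < r x
    p<rx = <-≤-trans p<rb (Between.rb≤rx (between (head-inside s)))

  RowNext : ℕ → List (Box n) → Set
  RowNext κ L = suc κ ≡ c y ⊎ HasBoxAt L (r y) (suc κ)

  row-successor : ∀ {b L κ} → Suffix (b ∷ L) → r b ≡ r y → c b ≡ κ → c x ≤ κ → RowNext κ L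
  row-successor {b} {L} {κ} s rb≡ry cb≡κ cx≤κ with suc κ ≟ c y
  ... | yes 1+κ≡cy = inj₁ 1+κ≡cy
  ... | no 1+κ≢cy = inj₂ (successor-in-tail s d
      (coord⇒<Q x d (<⇒≤ ry<rx , m≤n⇒m≤1+n cx≤κ , inj₁ ry<rx) , coord⇒<Q d y (≤-refl , <⇒≤ 1+κ<cy , inj₂ 1+κ<cy))
      (coord⇒<Q b d (≤-reflexive (sym rb≡ry) , m≤n⇒m≤1+n (≤-reflexive cb≡κ) , inj₂ (s≤s (≤-reflexive cb≡κ)))))
    where
    κ<cy : κ < c y
    κ<cy with Between.y-strict (between (head-inside s))
    ... | inj₁ ry<rb = ⊥-elim (<-irrefl (sym rb≡ry) ry<rb)
    ... | inj₂ cb<cy = subst (_< c y) cb≡κ cb<cy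
    1+κ<cy : suc κ < c y
    1+κ<cy = ≤∧≢⇒< κ<cy 1+κ≢cy
    d : Box n
    d = boxAt (r y) (suc κ) (row≥1 y) (row≤n y) (s≤s z≤n)
      (≤-trans (+-monoʳ-≤ (r y) (<⇒≤ 1+κ<cy)) (≤-reflexive y-diag))

  row-skip : ∀ {κ b} → Open x y b → Beyond (r y) κ b → r y < r b ⊎ c b < suc κ →
    τ F b (+ (r y + κ)) ≡ + (r y + κ)
  row-skip {κ} {b} ob beyond before = τ-fix-beyond F b (r y) κ ry<rb κ<cb
    where
    κ<cb : κ < c b
    κ<cb = fromInj₂ (λ rb<ry → ⊥-elim (<⇒≱ rb<ry (Between.ry≤rb (between ob)))) beyond
    ry<rb : r y < r b
    ry<rb = fromInj₁ (λ cb≤κ → ⊥-elim (<⇒≱ κ<cb (≤-pred cb≤κ))) before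

  column-skip : ∀ {p b} → Open x y b → Beyond (suc p) (c x) b → p < r b ⊎ c b < c x →
    τ F b (+ (p + c x)) ≡ + (p + c x)
  column-skip {p} {b} ob beyond before = τ-fix-beyond F b p (c x) p<rb cx<cb
    where
    p<rb : p < r b
    p<rb = fromInj₁ (λ cb<cx → ⊥-elim (<⇒≱ cb<cx (Between.cx≤cb (between ob)))) before
    cx<cb : c x < c b
    cx<cb = fromInj₂ (λ rb≤p → ⊥-elim (<⇒≱ p<rb (≤-pred rb≤p))) beyond

  -- In the row phase the box (r y, κ) has been applied and has sent n to r y + κ; in
  -- the column phase the next box is (p, c x) and n has been sent to p + c x.
  track-row : ∀ κ L → c x ≤ κ → Suffix L → All (Beyond (r y) κ) L → RowNext κ L →
    applyAll (τ F) L (+ (r y + κ)) ≡ + n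
  track-row κ [] _ _ _ (inj₁ 1+κ≡cy) =
    cong +_ (suc-injective (trans (sym (+-suc (r y) κ)) (trans (cong (λ t → r y + t) 1+κ≡cy) y-diag)))
  track-row κ (b ∷ L) cx≤κ s (beyond ∷ beyonds) (inj₁ 1+κ≡cy) =
    trans (cong (applyAll (τ F) L) (row-skip (head-inside s) beyond
            (map₂ (subst (c b <_) (sym 1+κ≡cy)) (Between.y-strict (between (head-inside s))))))
          (track-row κ L cx≤κ (Suffix-tail s) beyonds (inj₁ 1+κ≡cy))
  track-row κ (b ∷ L) cx≤κ s (beyond ∷ beyonds) (inj₂ (there at)) =
    trans (cong (applyAll (τ F) L) (row-skip (head-inside s) beyond (before-box s at)))
          (track-row κ L cx≤κ (Suffix-tail s) beyonds (inj₂ at))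
  track-row κ (b ∷ L) cx≤κ s (_ ∷ _) (inj₂ (here (rb≡ry , cb≡1+κ))) =
    trans (cong (applyAll (τ F) L) step)
          (subst (λ t → applyAll (τ F) L (+ t) ≡ + n) (+-suc (r y) κ)
             (track-row (suc κ) L cx≤1+κ (Suffix-tail s) (after-box s rb≡ry cb≡1+κ)
                (row-successor s rb≡ry cb≡1+κ cx≤1+κ)))
    where
    cx≤1+κ : c x ≤ suc κ
    cx≤1+κ = m≤n⇒m≤1+n cx≤κ
    1+κ<cy : suc κ < c y
    1+κ<cy with Between.y-strict (between (head-inside s))
    ... | inj₁ ry<rb = ⊥-elim (<-irrefl (sym rb≡ry) ry<rb)
    ... | inj₂ cb<cy = subst (_< c y) cb≡1+κ cb<cy
    ry+κ<n : r y + κ < n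
    ry+κ<n = ≤-pred (subst₂ _<_ (+-suc (r y) κ) y-diag (+-monoʳ-< (r y) 1+κ<cy))
    step : τ F b (+ (r y + κ)) ≡ + suc (r y + κ)
    step = trans (τ-zero F b (F-elsewhere (head-inside s) (inj₂ λ cb≡cx → <⇒≢ (s≤s cx≤κ) (trans (sym cb≡cx) cb≡1+κ)))
                   (label≡ b (trans (cong₂ _+_ rb≡ry cb≡1+κ) (+-suc (r y) κ))) _)
                 (σ-up ry+κ<n)

  track-column : ∀ p L → r y ≤ p → Suffix L → All (Beyond (suc p) (c x)) L → HasBoxAt L p (c x) →
    applyAll (τ F) L (+ (p + c x)) ≡ + n
  track-column zero _ ry≤0 _ _ _ = ⊥-elim (<⇒≱ (row≥1 y) ry≤0)
  track-column p (b ∷ L) ry≤p s (beyond ∷ beyonds) (there at) =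
    trans (cong (applyAll (τ F) L) (column-skip (head-inside s) beyond (before-box s at)))
          (track-column p L ry≤p (Suffix-tail s) beyonds at)
  track-column (suc p) (b ∷ L) ry≤1+p s (_ ∷ _) (here (rb≡1+p , cb≡cx)) with suc p ≟ r y
  ... | yes 1+p≡ry =
    trans (cong (applyAll (τ F) L) (τ-plus F b (F-corner (head-inside s) rb≡ry cb≡cx) _))
          (subst (λ t → applyAll (τ F) L (+ (t + c x)) ≡ + n) (sym 1+p≡ry)
             (track-row (c x) L ≤-refl (Suffix-tail s) (after-box s rb≡ry cb≡cx)
                (row-successor s rb≡ry cb≡cx ≤-refl)))
    where
    rb≡ry : r b ≡ r y
    rb≡ry = trans rb≡1+p 1+p≡ry
  ... | no 1+p≢ry =
    trans (cong (applyAll (τ F) L) step)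
          (track-column p L ry≤p (Suffix-tail s) (after-box s rb≡1+p cb≡cx)
             (column-successor s rb≡1+p cb≡cx ry≤p))
    where
    ry≤p : r y ≤ p
    ry≤p = ≤-pred (≤∧≢⇒< ry≤1+p (≢-sym 1+p≢ry))
    1+p<rx : suc p < r x
    1+p<rx with Between.x-strict (between (head-inside s))
    ... | inj₁ rb<rx = subst (_< r x) rb≡1+p rb<rx
    ... | inj₂ cx<cb = ⊥-elim (<-irrefl (sym cb≡cx) cx<cb)
    p+cx<n : p + c x < n
    p+cx<n = ≤-pred (subst (suc (suc p) + c x ≤_) x-diag (+-monoˡ-≤ (c x) 1+p<rx))
    step : τ F b (+ (suc p + c x)) ≡ + (p + c x)
    step = trans (τ-zero F b (F-elsewhere (head-inside s) (inj₁ λ rb≡ry → 1+p≢ry (trans (sym rb≡1+p) rb≡ry)))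
                   (label≡ b (cong₂ _+_ rb≡1+p cb≡cx)) _)
                 (σ-down p+cx<n)

  applyAll-fixes-n : ∀ L → Suffix L → (∀ {d} → Open x y d → d ∈ L) → applyAll (τ F) L (+ n) ≡ + n
  applyAll-fixes-n L s complete =
    subst (λ t → applyAll (τ F) L (+ t) ≡ + n) p+cx≡n (track-column p L ry≤p s beyonds first-box)
    where
    p : ℕ
    p = pred (r x)
    1+p≡rx : suc p ≡ r x
    1+p≡rx = suc-pred (r x) {{>-nonZero (row≥1 x)}}
    p+cx≡n : p + c x ≡ n
    p+cx≡n = suc-injective (trans (cong (_+ c x) 1+p≡rx) x-diag)
    ry≤p : r y ≤ p
    ry≤p = <⇒≤pred ry<rx
    p<rx : p < r x
    p<rx = ≤-reflexive 1+p≡rx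
    beyonds : All (Beyond (suc p) (c x)) L
    beyonds = All.map (λ {b} ob → subst (λ t → Beyond t (c x) b) (sym 1+p≡rx) (Between.x-strict (between ob)))
                      (Suffix.inside s)
    first-box : HasBoxAt L p (c x)
    first-box = Any.map (λ { refl → refl , refl }) (complete (columnBox-inside ry≤p p<rx))

Γ-identity : ∀ {n} (x y : Box n) (D : Box n → Fill) →
  r x + c x ≡ suc n → r y + c y ≡ suc n → x <Q y → Compatible x y (S₁ x y) D →
  ∀ L₁ L₂ → IsLinExt (HalfL x y) L₁ → IsLinExt (HalfR x y) L₂ → vList (D ∪at x) L₁ ≡ vList (D ∪at y) L₂
Γ-identity {n} x y D x-diag y-diag x<y compatible L₁ L₂ ext₁ ext₂@(_ , unique₂ , _ , index₂<)
  with halfL-linExt x<y ext₁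
... | L , refl , ext = vList-≡ F G (x ∷ L) L₂ λ z → begin
    applyAll (τ F) (x ∷ L) z      ≡⟨ cong (applyAll (τ F) L) (τ-zero F x (∪at-here D x) (label≡ x x-diag) z) ⟩
    applyAll (τ F) L (σ n n z)    ≡⟨ σₙ-comm 1≤n (applyAll (τ F) L) (applyAll-odd F L) (applyAll-injective F L) fixes z ⟨
    σ n n (applyAll (τ F) L z)    ≡⟨ cong (σ n n) (applyAll-agree F G L agree z) ⟩
    σ n n (applyAll (τ G) L z)    ≡⟨ τ-zero G y (∪at-here D y) (label≡ y y-diag) _ ⟨
    τ G y (applyAll (τ G) L z)    ≡⟨ foldl-∷ʳ (λ acc b → τ G b acc) z y L ⟨
    applyAll (τ G) (L ∷ʳ y) z     ≡⟨ applyAll-reorder (L ∷ʳ y) L₂ (snoc-unique x<y ext ext₂) unique₂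
                                       (snoc-ordered x<y ext ext₂) (linExt-ordered L₂ index₂<)
                                       (⊆halfR x<y ext ext₂) (halfR⊆ x<y ext ext₂) z ⟩
    applyAll (τ G) L₂ z           ∎
  where
  open ≡-Reasoning
  open Hook x y D x-diag y-diag x<y compatible
  open OpenLinExt ext
  open Reorder _<Q_ (τ (D ∪at y)) (τ-incomparable (D ∪at y))
  G : Box n → Fill
  G = D ∪at y
  1≤n : 1 ≤ n
  1≤n = ≤-trans (row≥1 x) (row≤n x)
  fixes : applyAll (τ F) L (+ n) ≡ + n
  fixes = applyAll-fixes-n L
    (record { unique = unique ; ordered = ordered ; inside = inside ; closed = λ _ od → inj₁ (complete od) })
    complete
  agree : All (λ b → F b ≡ G b) L
  agree = All.map (λ ob → trans (F≡D ob) (sym (D∪y≡D ob))) inside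

mainTheorem5 : ∀ (n : ℕ) (O : Box n → Set) → IsOrderIdeal O →
    ∀ (x y : Box n) → O x → O y → Diagonal x → Diagonal y →
    x <Q y → IsΓMove x y (S₁ x y)
mainTheorem5 n O _ x y _ _ x-diag y-diag x<y =
  x<y , λ D compatible → Γ-identity x y D (diagonal⇒row+col x x-diag) (diagonal⇒row+col y y-diag) x<y compatible
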